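{- Let $m\ge 1$, $n\ge 0$ and $h$ be integers. The number of partitions $\lambda$ of $n$ with an $h$-fixed hook in the $m$th column arising from a part of size $m$ (i.e. for which there is a row $i$ with $\lambda_i=m$ and $h_{i,m}(\lambda)=i+h$) equals the number of partitions of $n-mh$ in which $m$ appears as a part exactly once, there are no parts of sizes $m+1,m+2,\ldots,2m-1$, and there are at least $-h$ parts of size at least $2m$.
   Context: For a partition $\lambda=(\lambda_1\ge\lambda_2\ge\cdots)$ with conjugate $\lambda'$, the hook length of the cell $(i,j)$ (with $j\le\lambda_i$) of its Young diagram is $h_{i,j}(\lambda)=\lambda_i+\lambda'_j-i-j+1$. For an integer $h$, an $h$-fixed hook in the $m$th column is a row index $i$ with $\lambda_i\ge m$ and $h_{i,m}(\lambda)=i+h$; it "arises from a part of size $k$" if $\lambda_i=k$. -}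

module Defs where

open import Data.Nat as ℕ using (ℕ; zero; suc; _≤_; _<_; _*_; _≤?_; _≟_)
open import Data.Integer as ℤ using (ℤ; +_; _+_; _-_)
open import Data.List using (List; []; _∷_; length; filter)
open import Data.Nat.ListAction using (sum)
open import Data.List.Relation.Unary.All using (All)
open import Data.List.Relation.Unary.Linked using (Linked)
open import Data.Product using (Σ; _×_)
open import Data.Sum using (_⊎_)
open import Relation.Binary.PropositionalEquality using (_≡_)

IsPartition : List ℕ → Set
IsPartition l = Linked ℕ._≥_ l × All (λ x → 0 < x) l

PartitionOf : ℤ → Set
PartitionOf N = Σ (List ℕ) (λ l → IsPartition l × (+ sum l ≡ N))

-- λ_i with 1-based row index i; 0 for rows beyond the length (and for i = 0).
part : List ℕ → ℕ → ℕ
part []      _             = 0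
part (x ∷ l) zero          = 0
part (x ∷ l) (suc zero)    = x
part (x ∷ l) (suc (suc i)) = part l (suc i)

conj : List ℕ → ℕ → ℕ
conj l j = length (filter (j ≤?_) l)

hook : List ℕ → ℕ → ℕ → ℤ
hook l i j = + part l i + + conj l j - + i - + j + + 1

FixedHookFromPart : ℤ → ℕ → List ℕ → Set
FixedHookFromPart h m l =
  Σ ℕ (λ i → (1 ≤ i) × (m ≤ part l i) × (part l i ≡ m) × (hook l i m ≡ + i + h))

mult : ℕ → List ℕ → ℕ
mult k l = length (filter (_≟ k) l)

partsAtLeast : ℕ → List ℕ → ℕ
partsAtLeast k l = length (filter (k ≤?_) l)

RightCondition : ℤ → ℕ → List ℕ → Set
RightCondition h m l =
  (mult m l ≡ 1) ×
  All (λ x → (x ≤ m) ⊎ (2 * m ≤ x)) l ×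
  (ℤ.- h ℤ.≤ + partsAtLeast (2 * m) l)

-- Write λ = X ++ m^(u+1) ++ S, where the fixed hook sits in the first row of the block of
-- parts equal to m, X are the parts above that row (all ≥ m) and S the parts below m.
-- That hook has length u + 1 and lies in row |X| + 1, so it is h-fixed exactly when
-- h = u − |X|.  Adding m to every part of X and collapsing the block m^(u+1) to a single m
-- gives μ = (X + m) ++ m ∷ S, a partition of n − m(u + 1) + m|X| + m = n − mh with m as a
-- part exactly once, no part strictly between m and 2m, and |X| = u − h ≥ −h parts ≥ 2m.
-- Conversely μ determines X and S, and u = h + |X| ≥ 0, so this is a bijection.

module Submission where

open import Defs
open import Data.Nat as ℕ using (ℕ; zero; suc; _+_; _∸_; _≤_; _<_; _≤?_; _≟_; z≤n; s≤s)
import Data.Nat.Properties as ℕ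
open import Algebra.Properties.CommutativeSemigroup ℕ.+-commutativeSemigroup using () renaming (interchange to +-interchange)
open import Data.Nat.ListAction using (sum)
open import Data.Nat.ListAction.Properties using (sum-++)
import Data.Nat.Tactic.RingSolver as ℕ-Solver
open import Data.Integer as ℤ using (ℤ; +_; -_; _-_; _*_; ∣_∣)
import Data.Integer.Properties as ℤ
open import Data.Integer.Tactic.RingSolver using (solve-∀)
open import Data.List using (List; []; _∷_; _++_; [_]; map; replicate; length; filter; take; drop)
open import Data.List.Properties using (length-++; length-map; length-replicate; ++-assoc; filter-++; filter-all; filter-none; filter-reject; map-∘; map-id-local)
open import Data.List.Relation.Unary.All as All using (All; []; _∷_)
import Data.List.Relation.Unary.All.Properties as All
open import Data.List.Relation.Unary.Linked as Linked using (Linked; []; [-]; _∷_)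
import Data.List.Relation.Unary.Linked.Properties as Linked
open import Data.Product using (Σ; ∃-syntax; _×_; _,_; proj₁; proj₂)
open import Data.Sum using (_⊎_; inj₁; inj₂)
open import Function.Base using (_∘_)
open import Function.Bundles using (_↔_; mk↔ₛ′)
open import Level using (0ℓ)
open import Relation.Binary.Core using (Rel)
open import Relation.Binary.PropositionalEquality using (_≡_; refl; sym; trans; cong; cong₂; subst; subst₂; module ≡-Reasoning)
open import Relation.Nullary using (¬_; yes; no; contradiction)
open import Relation.Unary using (Pred; Decidable; ∁)
open import Axiom.UniquenessOfIdentityProofs using (module Decidable⇒UIP)

Sorted : List ℕ → Set
Sorted = Linked ℕ._≥_

linked-++⁻ : ∀ {A : Set} {R : Rel A 0ℓ} xs {ys} → Linked R (xs ++ ys) → Linked R xs × Linked R ys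
linked-++⁻ []           r        = [] , r
linked-++⁻ (x ∷ [])     r        = [-] , Linked.tail r
linked-++⁻ (x ∷ y ∷ xs) (r ∷ rs) = let (p , q) = linked-++⁻ (y ∷ xs) rs in r ∷ p , q

sorted-++⁺ : ∀ {k xs ys} → All (k ≤_) xs → All (_≤ k) ys → Sorted xs → Sorted ys → Sorted (xs ++ ys)
sorted-++⁺ {xs = []}                  _          _         _        s = s
sorted-++⁺ {xs = _ ∷ []}    {[]}      _          _         _        _ = [-]
sorted-++⁺ {xs = _ ∷ []}    {_ ∷ _}   (k≤x ∷ _)  (y≤k ∷ _) _        s = ℕ.≤-trans y≤k k≤x ∷ s
sorted-++⁺ {xs = _ ∷ _ ∷ _}           (_ ∷ k≤xs) ys≤k      (r ∷ rs) s = r ∷ sorted-++⁺ k≤xs ys≤k rs s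

sorted-replicate : ∀ k x → Sorted (replicate k x)
sorted-replicate 0             x = []
sorted-replicate 1             x = [-]
sorted-replicate (suc (suc k)) x = ℕ.≤-refl ∷ sorted-replicate (suc k) x

sorted-map-+⁻ : ∀ m {xs} → Sorted (map (_+ m) xs) → Sorted xs
sorted-map-+⁻ m s = Linked.map (ℕ.+-cancelʳ-≤ m _ _) (Linked.map⁻ s)

sorted⇒All≤head : ∀ {x xs} → Sorted (x ∷ xs) → All (_≤ x) xs
sorted⇒All≤head [-]      = []
sorted⇒All≤head (r ∷ rs) = Linked.Linked⇒All (λ a b → ℕ.≤-trans b a) r rs

sorted⇒≤head : ∀ {x} xs {y ys} → Sorted (x ∷ xs ++ y ∷ ys) → y ≤ x
sorted⇒≤head xs s = All.head (All.++⁻ʳ xs (sorted⇒All≤head s))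

isPartition-++⁺ : ∀ {k xs ys} → All (k ≤_) xs → All (_≤ k) ys → IsPartition xs → IsPartition ys → IsPartition (xs ++ ys)
isPartition-++⁺ k≤xs ys≤k (sx , px) (sy , py) = sorted-++⁺ k≤xs ys≤k sx sy , All.++⁺ px py

isPartition-++⁻ : ∀ xs {ys} → IsPartition (xs ++ ys) → IsPartition xs × IsPartition ys
isPartition-++⁻ xs (s , p) =
  let (sx , sy) = linked-++⁻ xs s in (sx , All.++⁻ˡ xs p) , (sy , All.++⁻ʳ xs p)

isPartition-irrelevant : ∀ {l} (p q : IsPartition l) → p ≡ q
isPartition-irrelevant (s , p) (s′ , p′) =
  cong₂ _,_ (Linked.irrelevant ℕ.≤-irrelevant s s′) (All.irrelevant ℕ.<-irrelevant p p′)

module _ {A : Set} {P : Pred A 0ℓ} (P? : Decidable P) where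

  length-filter-++ : ∀ xs ys → length (filter P? (xs ++ ys)) ≡ length (filter P? xs) + length (filter P? ys)
  length-filter-++ xs ys = trans (cong length (filter-++ P? xs ys)) (length-++ (filter P? xs))

  length-filter-none : ∀ {xs} → All (∁ P) xs → length (filter P? xs) ≡ 0
  length-filter-none = cong length ∘ filter-none P?

  length-filter-all-none : ∀ {xs ys} → All P xs → All (∁ P) ys → length (filter P? (xs ++ ys)) ≡ length xs
  length-filter-all-none {xs} {ys} pxs ¬pys = begin
    length (filter P? (xs ++ ys))                  ≡⟨ length-filter-++ xs ys ⟩
    length (filter P? xs) + length (filter P? ys)  ≡⟨ cong₂ _+_ (cong length (filter-all P? pxs)) (length-filter-none ¬pys) ⟩
    length xs + 0                                  ≡⟨ ℕ.+-identityʳ _ ⟩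
    length xs                                      ∎
    where open ≡-Reasoning

take-length-++ : ∀ {A : Set} (xs : List A) {ys} → take (length xs) (xs ++ ys) ≡ xs
take-length-++ []       = refl
take-length-++ (x ∷ xs) = cong (x ∷_) (take-length-++ xs)

drop-length-++ : ∀ {A : Set} (xs : List A) {ys} → drop (length xs) (xs ++ ys) ≡ ys
drop-length-++ []       = refl
drop-length-++ (x ∷ xs) = drop-length-++ xs

sum-replicate : ∀ k x → sum (replicate k x) ≡ k ℕ.* x
sum-replicate zero    x = refl
sum-replicate (suc k) x = cong (_+_ x) (sum-replicate k x)

sum-map-+ : ∀ m xs → sum (map (_+ m) xs) ≡ sum xs + length xs ℕ.* m
sum-map-+ m []       = refl
sum-map-+ m (x ∷ xs) = begin
  x + m + sum (map (_+ m) xs)       ≡⟨ cong (_+_ (x + m)) (sum-map-+ m xs) ⟩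
  x + m + (sum xs + length xs ℕ.* m) ≡⟨ +-interchange x m (sum xs) _ ⟩
  x + sum xs + (m + length xs ℕ.* m) ∎
  where open ≡-Reasoning

map-+-∸ : ∀ m xs → map (_∸ m) (map (_+ m) xs) ≡ xs
map-+-∸ m xs = trans (sym (map-∘ xs)) (map-id-local (All.tabulate λ {x} _ → ℕ.m+n∸n≡m x m))

part-length-++ : ∀ xs y ys → part (xs ++ y ∷ ys) (suc (length xs)) ≡ y
part-length-++ []       y ys = refl
part-length-++ (x ∷ xs) y ys = part-length-++ xs y ys

partsAtLeast-++ : ∀ {k xs ys} → All (k ≤_) xs → All (_< k) ys → partsAtLeast k (xs ++ ys) ≡ length xs
partsAtLeast-++ {k} k≤xs ys<k = length-filter-all-none (k ≤?_) k≤xs (All.map ℕ.<⇒≱ ys<k)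

-- For a sorted list, the parts smaller than m.
partsBelow : ℕ → List ℕ → List ℕ
partsBelow m l = drop (partsAtLeast m l) l

partsBelow-++ : ∀ {m xs ys} → All (m ≤_) xs → All (_< m) ys → partsBelow m (xs ++ ys) ≡ ys
partsBelow-++ {xs = xs} m≤xs ys<m = trans (cong (λ k → drop k _) (partsAtLeast-++ m≤xs ys<m)) (drop-length-++ xs)

offset-of-hook : ∀ {u c h} → + suc u ≡ + suc c ℤ.+ h → h ≡ + u - + c
offset-of-hook {u} {c} {h} eq = begin
  h                             ≡⟨ cancel (+ suc c) h ⟩
  (+ suc c ℤ.+ h) - + suc c     ≡⟨ cong (_- + suc c) eq ⟨
  + suc u - + suc c             ≡⟨ shift (+ u) (+ c) ⟩
  + u - + c                     ∎
  where
  open ≡-Reasoning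
  cancel : ∀ a b → b ≡ (a ℤ.+ b) - a
  cancel = solve-∀
  shift : ∀ U C → (+ 1 ℤ.+ U) - (+ 1 ℤ.+ C) ≡ U - C
  shift = solve-∀

hook-of-offset : ∀ u c → + suc c ℤ.+ (+ u - + c) ≡ + suc u
hook-of-offset u c = lemma (+ u) (+ c)
  where
  lemma : ∀ U C → (+ 1 ℤ.+ C) ℤ.+ (U - C) ≡ + 1 ℤ.+ U
  lemma = solve-∀

offset-of-bound : ∀ {h c} → - h ℤ.≤ + c → ∃[ u ] h ≡ + u - + c
offset-of-bound {h} {c} -h≤c = ∣ h ℤ.+ + c ∣ , (begin
  h                      ≡⟨ lemma h (+ c) ⟩
  (h ℤ.+ + c) - + c      ≡⟨ cong (_- + c) (ℤ.0≤i⇒+∣i∣≡i 0≤h+c) ⟨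
  + ∣ h ℤ.+ + c ∣ - + c  ∎)
  where
  open ≡-Reasoning
  lemma : ∀ a b → a ≡ (a ℤ.+ b) - b
  lemma = solve-∀
  0≤h+c : + 0 ℤ.≤ h ℤ.+ + c
  0≤h+c = subst (ℤ._≤ h ℤ.+ + c) (ℤ.+-inverseʳ h) (ℤ.+-monoʳ-≤ h -h≤c)

bound-of-offset : ∀ u c → - (+ u - + c) ℤ.≤ + c
bound-of-offset u c = ℤ.≤-trans (ℤ.i≤i+j (- (+ u - + c)) (+ u)) (ℤ.≤-reflexive (lemma (+ u) (+ c)))
  where
  lemma : ∀ U C → - (U - C) ℤ.+ U ≡ C
  lemma = solve-∀

∣offset∣ : ∀ u c → ∣ (+ u - + c) ℤ.+ + c ∣ ≡ u
∣offset∣ u c = cong ∣_∣ (lemma (+ u) (+ c))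
  where
  lemma : ∀ U C → (U - C) ℤ.+ C ≡ U
  lemma = solve-∀

sum-shift-ℤ : ∀ {a b} m u c → a + m ℕ.* u ≡ b + m ℕ.* c → + a ≡ + b - + m * (+ u - + c)
sum-shift-ℤ {a} {b} m u c eq = begin
  + a                                 ≡⟨ cancel (+ a) (+ m * + u) ⟩
  (+ a ℤ.+ + m * + u) - + m * + u     ≡⟨ cong (_- + m * + u) eqℤ ⟩
  (+ b ℤ.+ + m * + c) - + m * + u     ≡⟨ regroup (+ b) (+ m) (+ u) (+ c) ⟩
  + b - + m * (+ u - + c)             ∎
  where
  open ≡-Reasoning
  cancel : ∀ A K → A ≡ (A ℤ.+ K) - K
  cancel = solve-∀
  regroup : ∀ B M U C → (B ℤ.+ M * C) - M * U ≡ B - M * (U - C)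
  regroup = solve-∀
  eqℤ : + a ℤ.+ + m * + u ≡ + b ℤ.+ + m * + c
  eqℤ = begin
    + a ℤ.+ + m * + u        ≡⟨ cong (ℤ._+_ (+ a)) (ℤ.pos-* m u) ⟨
    + (a + m ℕ.* u)          ≡⟨ cong +_ eq ⟩
    + (b + m ℕ.* c)          ≡⟨ cong (ℤ._+_ (+ b)) (ℤ.pos-* m c) ⟩
    + b ℤ.+ + m * + c        ∎

sub-cancelʳ : ∀ {i j k} → i - k ≡ j - k → i ≡ j
sub-cancelʳ {i} {j} {k} eq = begin
  i                ≡⟨ lemma i k ⟩
  (i - k) ℤ.+ k    ≡⟨ cong (λ z → z ℤ.+ k) eq ⟩
  (j - k) ℤ.+ k    ≡⟨ lemma j k ⟨
  j                ∎
  where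
  open ≡-Reasoning
  lemma : ∀ a b → a ≡ (a - b) ℤ.+ b
  lemma = solve-∀

Gap : ℕ → ℕ → Set
Gap m x = x ≤ m ⊎ 2 ℕ.* m ≤ x

2m≤x+m : ∀ {m x} → m ≤ x → 2 ℕ.* m ≤ x + m
2m≤x+m {m} {x} m≤x = subst (_≤ x + m) (cong (_+_ m) (sym (ℕ.+-identityʳ m))) (ℕ.+-monoˡ-≤ m m≤x)

gap-above : ∀ {m x} → m < x → Gap m x → 2 ℕ.* m ≤ x
gap-above m<x (inj₁ x≤m)  = contradiction x≤m (ℕ.<⇒≱ m<x)
gap-above m<x (inj₂ 2m≤x) = 2m≤x

m≤x∸m : ∀ {m x} → 2 ℕ.* m ≤ x → m ≤ x ∸ m
m≤x∸m {m} {x} 2m≤x = ℕ.m+n≤o⇒m≤o∸n m (subst (_≤ x) (cong (_+_ m) (ℕ.+-identityʳ m)) 2m≤x)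

unshift : ∀ {m C} → All (2 ℕ.* m ≤_) C → ∃[ X ] All (m ≤_) X × map (_+ m) X ≡ C
unshift {m} {C} 2m≤C =
  map (_∸ m) C ,
  All.map⁺ (All.map m≤x∸m 2m≤C) ,
  trans (sym (map-∘ C)) (map-id-local (All.map (ℕ.m∸n+n≡m ∘ ℕ.≤-trans (ℕ.m≤m+n m _)) 2m≤C))

module _ {m : ℕ} (1≤m : 1 ≤ m) where

  m<2m : m < 2 ℕ.* m
  m<2m = subst (m <_) (cong (_+_ m) (sym (ℕ.+-identityʳ m))) (ℕ.m<m+n m 1≤m)

  gap-irrelevant : ∀ {x} (p q : Gap m x) → p ≡ q
  gap-irrelevant (inj₁ p) (inj₁ q) = cong inj₁ (ℕ.≤-irrelevant p q)
  gap-irrelevant (inj₂ p) (inj₂ q) = cong inj₂ (ℕ.≤-irrelevant p q)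
  gap-irrelevant (inj₁ p) (inj₂ q) = contradiction (ℕ.≤-trans q p) (ℕ.<⇒≱ m<2m)
  gap-irrelevant (inj₂ p) (inj₁ q) = contradiction (ℕ.≤-trans p q) (ℕ.<⇒≱ m<2m)

ℤ-≡-irrelevant : ∀ {i j : ℤ} (p q : i ≡ j) → p ≡ q
ℤ-≡-irrelevant = Decidable⇒UIP.≡-irrelevant ℤ._≟_

rightCondition-irrelevant : ∀ {h m μ} → 1 ≤ m → (p q : RightCondition h m μ) → p ≡ q
rightCondition-irrelevant 1≤m (once , gaps , bound) (once′ , gaps′ , bound′)
  with ℕ.≡-irrelevant once once′ | All.irrelevant (gap-irrelevant 1≤m) gaps gaps′ | ℤ.≤-irrelevant bound bound′
... | refl | refl | refl = refl

raise : ℕ → ℕ → List ℕ → List ℕ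
raise m j l = map (_+ m) (take j l) ++ m ∷ partsBelow m l

-- Meant for −h ≤ c, as RightCondition guarantees; otherwise ∣ h + c ∣ is a junk value.
lower : ℕ → ℤ → List ℕ → List ℕ
lower m h μ = map (_∸ m) (take c μ) ++ replicate (suc ∣ h ℤ.+ + c ∣) m ++ partsBelow m μ
  where c = partsAtLeast (2 ℕ.* m) μ

hookShape : ℕ → List ℕ → ℕ → List ℕ → List ℕ
hookShape m X u S = X ++ replicate (suc u) m ++ S

raisedShape : ℕ → List ℕ → List ℕ → List ℕ
raisedShape m X S = map (_+ m) X ++ m ∷ S

isPartition-hookShape⁻ : ∀ {m} X u S → IsPartition (hookShape m X u S) → Sorted X × IsPartition S
isPartition-hookShape⁻ {m} X u S p =
  let (pX , pR) = isPartition-++⁻ X p in proj₁ pX , proj₂ (isPartition-++⁻ (replicate (suc u) m) pR)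

isPartition-raisedShape⁻ : ∀ {m} X S → IsPartition (raisedShape m X S) → Sorted X × IsPartition S
isPartition-raisedShape⁻ {m} X S p =
  let (pY , pR) = isPartition-++⁻ (map (_+ m) X) p in sorted-map-+⁻ m (proj₁ pY) , proj₂ (isPartition-++⁻ [ m ] pR)

data CopiesThenBelow (m : ℕ) : List ℕ → Set where
  copiesThenBelow : ∀ {S} k → All (_< m) S → CopiesThenBelow m (replicate k m ++ S)

copiesThenBelow-of : ∀ {m l} → All (_≤ m) l → Sorted l → CopiesThenBelow m l
copiesThenBelow-of {l = []} _ _ = copiesThenBelow 0 []
copiesThenBelow-of {m} {x ∷ l} (x≤m ∷ l≤m) s with x ≟ m
... | yes refl with copiesThenBelow-of l≤m (Linked.tail s)
...   | copiesThenBelow k S<m = copiesThenBelow (suc k) S<m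
copiesThenBelow-of {m} {x ∷ l} (x≤m ∷ _) s | no x≢m =
  copiesThenBelow 0 (x<m ∷ All.map (λ y≤x → ℕ.≤-<-trans y≤x x<m) (sorted⇒All≤head s))
  where x<m = ℕ.≤∧≢⇒< x≤m x≢m

mult-copiesThenBelow : ∀ {m} k {S} → All (_< m) S → mult m (replicate k m ++ S) ≡ k
mult-copiesThenBelow {m} k S<m =
  trans (length-filter-all-none (_≟ m) (All.replicate⁺ k refl) (All.map (λ y<m y≡m → ℕ.<-irrefl y≡m y<m) S<m))
        (length-replicate k)

data HookRow (m : ℕ) : List ℕ → ℕ → Set where
  hookRow : ∀ {X S} u → All (m ≤_) X → All (_< m) S → HookRow m (hookShape m X u S) (length X)

hookRow-of : ∀ {m l j} → 1 ≤ m → Sorted l → part l (suc j) ≡ m → HookRow m l j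
hookRow-of {l = []} 1≤m _ 0≡m = contradiction 0≡m (ℕ.<⇒≢ 1≤m)
hookRow-of {l = x ∷ l} {zero} _ s refl with copiesThenBelow-of (sorted⇒All≤head s) (Linked.tail s)
... | copiesThenBelow u S<m = hookRow u [] S<m
hookRow-of {l = x ∷ l} {suc j} 1≤m s eq with hookRow-of 1≤m (Linked.tail s) eq
... | hookRow {X} u m≤X S<m = hookRow u (sorted⇒≤head X s ∷ m≤X) S<m

data OneCopy (m : ℕ) : List ℕ → Set where
  oneCopy : ∀ {C S} → All (m <_) C → All (_< m) S → OneCopy m (C ++ m ∷ S)

oneCopy-of : ∀ {m μ} → Sorted μ → mult m μ ≡ 1 → OneCopy m μ
oneCopy-of {μ = []} _ ()
oneCopy-of {m} {x ∷ μ} s once with x ≟ m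
... | yes refl with copiesThenBelow-of (sorted⇒All≤head s) (Linked.tail s)
...   | copiesThenBelow k S<m
        with ℕ.suc-injective (trans (sym (mult-copiesThenBelow (suc k) S<m)) once)
...     | refl = oneCopy [] S<m
oneCopy-of {m} {x ∷ μ} s once | no x≢m
  with oneCopy-of (Linked.tail s) (trans (sym (cong length (filter-reject (_≟ m) x≢m))) once)
... | oneCopy {C} m<C S<m = oneCopy (ℕ.≤∧≢⇒< (sorted⇒≤head C s) (x≢m ∘ sym) ∷ m<C) S<m

record Correspond (m : ℕ) (h : ℤ) (l : List ℕ) (j : ℕ) (μ : List ℕ) : Set where
  field
    isPartitionˡ   : IsPartition l
    isPartitionʳ   : IsPartition μ
    sum-shift      : + sum μ ≡ + sum l - + m * h
    part≡          : part l (suc j) ≡ m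
    hook≡          : hook l (suc j) m ≡ + suc j ℤ.+ h
    rightCondition : RightCondition h m μ
    raise≡         : raise m j l ≡ μ
    lower≡         : lower m h μ ≡ l
    row≡           : partsAtLeast (2 ℕ.* m) μ ≡ j

module Shapes {m : ℕ} (1≤m : 1 ≤ m) {X S : List ℕ} (m≤X : All (m ≤_) X) (S<m : All (_< m) S) where

  private
    S≤m : All (_≤ m) S
    S≤m = All.map ℕ.<⇒≤ S<m

    m≤copies : ∀ k → All (m ≤_) (replicate k m)
    m≤copies k = All.replicate⁺ k ℕ.≤-refl

    m≤X+m : All (m ≤_) (map (_+ m) X)
    m≤X+m = All.map⁺ (All.map (λ {x} _ → ℕ.m≤n+m m x) m≤X)

  partsAtLeast-hookShape : ∀ u → partsAtLeast m (hookShape m X u S) ≡ length X + suc u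
  partsAtLeast-hookShape u = begin
    partsAtLeast m (X ++ replicate (suc u) m ++ S)    ≡⟨ cong (partsAtLeast m) (++-assoc X _ S) ⟨
    partsAtLeast m ((X ++ replicate (suc u) m) ++ S)  ≡⟨ partsAtLeast-++ (All.++⁺ m≤X (m≤copies (suc u))) S<m ⟩
    length (X ++ replicate (suc u) m)                 ≡⟨ length-++ X ⟩
    length X + length (replicate (suc u) m)           ≡⟨ cong (_+_ (length X)) (length-replicate (suc u)) ⟩
    length X + suc u                                  ∎
    where open ≡-Reasoning

  hook-hookShape : ∀ u → hook (hookShape m X u S) (suc (length X)) m ≡ + suc u
  hook-hookShape u =
    trans (cong₂ (λ p c → + p ℤ.+ + c - + suc (length X) - + m ℤ.+ + 1) (part-length-++ X m _) (partsAtLeast-hookShape u))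
          (arith (+ m) (+ length X) (+ u))
    where
    arith : ∀ M C U → M ℤ.+ (C ℤ.+ (+ 1 ℤ.+ U)) - (+ 1 ℤ.+ C) - M ℤ.+ + 1 ≡ + 1 ℤ.+ U
    arith = solve-∀

  raise-hookShape : ∀ u → raise m (length X) (hookShape m X u S) ≡ raisedShape m X S
  raise-hookShape u = cong₂ (λ A B → map (_+ m) A ++ m ∷ B) (take-length-++ X) below
    where
    below : partsBelow m (hookShape m X u S) ≡ S
    below = trans (cong (partsBelow m) (sym (++-assoc X _ S))) (partsBelow-++ (All.++⁺ m≤X (m≤copies (suc u))) S<m)

  partsAtLeast-raisedShape : partsAtLeast (2 ℕ.* m) (raisedShape m X S) ≡ length X
  partsAtLeast-raisedShape =
    trans (partsAtLeast-++ (All.map⁺ (All.map 2m≤x+m m≤X)) (m<2m 1≤m ∷ All.map (λ y<m → ℕ.<-trans y<m (m<2m 1≤m)) S<m))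
          (length-map _ X)

  lower-raisedShape : ∀ u → lower m (+ u - + length X) (raisedShape m X S) ≡ hookShape m X u S
  lower-raisedShape u = begin
    lower m h M
      ≡⟨ cong (λ c → map (_∸ m) (take c M) ++ replicate (suc ∣ h ℤ.+ + c ∣) m ++ partsBelow m M) partsAtLeast-raisedShape ⟩
    map (_∸ m) (take (length X) M) ++ replicate (suc ∣ h ℤ.+ + length X ∣) m ++ partsBelow m M
      ≡⟨ cong₂ (λ A B → map (_∸ m) A ++ replicate (suc ∣ h ℤ.+ + length X ∣) m ++ B) take≡ below≡ ⟩
    map (_∸ m) (map (_+ m) X) ++ replicate (suc ∣ h ℤ.+ + length X ∣) m ++ S
      ≡⟨ cong₂ (λ A k → A ++ replicate (suc k) m ++ S) (map-+-∸ m X) (∣offset∣ u (length X)) ⟩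
    X ++ replicate (suc u) m ++ S
      ∎
    where
    open ≡-Reasoning
    h = + u - + length X
    M = raisedShape m X S
    take≡ : take (length X) M ≡ map (_+ m) X
    take≡ = subst (λ k → take k M ≡ map (_+ m) X) (length-map (_+ m) X) (take-length-++ (map (_+ m) X))
    below≡ : partsBelow m M ≡ S
    below≡ = trans (cong (partsBelow m) (sym (++-assoc (map (_+ m) X) [ m ] S)))
                   (partsBelow-++ (All.++⁺ m≤X+m (ℕ.≤-refl ∷ [])) S<m)

  mult-raisedShape : mult m (raisedShape m X S) ≡ 1
  mult-raisedShape =
    trans (length-filter-++ (_≟ m) (map (_+ m) X) (m ∷ S))
          (cong₂ _+_ (length-filter-none (_≟ m) X+m≢m) (length-filter-all-none (_≟ m) (refl ∷ []) S≢m))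
    where
    X+m≢m : All (λ y → ¬ y ≡ m) (map (_+ m) X)
    X+m≢m = All.map⁺ (All.map (λ {x} m≤x x+m≡m → ℕ.<-irrefl (sym x+m≡m) (ℕ.m<n+m m (ℕ.≤-trans 1≤m m≤x))) m≤X)
    S≢m : All (λ y → ¬ y ≡ m) S
    S≢m = All.map (λ y<m y≡m → ℕ.<-irrefl y≡m y<m) S<m

  gaps-raisedShape : All (Gap m) (raisedShape m X S)
  gaps-raisedShape = All.++⁺ (All.map⁺ (All.map (inj₂ ∘ 2m≤x+m) m≤X)) (inj₁ ℕ.≤-refl ∷ All.map (inj₁ ∘ ℕ.<⇒≤) S<m)

  sum-raisedShape : ∀ u → + sum (raisedShape m X S) ≡ + sum (hookShape m X u S) - + m * (+ u - + length X)
  sum-raisedShape u = sum-shift-ℤ m u (length X) (begin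
    sum (raisedShape m X S) + m ℕ.* u                    ≡⟨ cong (_+ m ℕ.* u) sumʳ ⟩
    sum X + length X ℕ.* m + (m + sum S) + m ℕ.* u       ≡⟨ regroup (sum X) (length X) m (sum S) u ⟩
    sum X + ((1 + u) ℕ.* m + sum S) + m ℕ.* length X     ≡⟨ cong (_+ m ℕ.* length X) sumˡ ⟨
    sum (hookShape m X u S) + m ℕ.* length X             ∎)
    where
    open ≡-Reasoning
    regroup : ∀ s c m t u → s + c ℕ.* m + (m + t) + m ℕ.* u ≡ s + ((1 + u) ℕ.* m + t) + m ℕ.* c
    regroup = ℕ-Solver.solve-∀
    sumʳ : sum (raisedShape m X S) ≡ sum X + length X ℕ.* m + (m + sum S)
    sumʳ = trans (sum-++ (map (_+ m) X) (m ∷ S)) (cong (_+ (m + sum S)) (sum-map-+ m X))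
    sumˡ : sum (hookShape m X u S) ≡ sum X + ((1 + u) ℕ.* m + sum S)
    sumˡ = trans (sum-++ X _) (cong (_+_ (sum X)) (trans (sum-++ (replicate (suc u) m) S) (cong (_+ sum S) (sum-replicate (suc u) m))))

  isPartition-hookShape : ∀ u → Sorted X → IsPartition S → IsPartition (hookShape m X u S)
  isPartition-hookShape u sX pS =
    isPartition-++⁺ m≤X (All.++⁺ (All.replicate⁺ (suc u) ℕ.≤-refl) S≤m) (sX , All.map (ℕ.≤-trans 1≤m) m≤X)
      (isPartition-++⁺ (m≤copies (suc u)) S≤m (sorted-replicate (suc u) m , All.replicate⁺ (suc u) 1≤m) pS)

  isPartition-raisedShape : Sorted X → IsPartition S → IsPartition (raisedShape m X S)
  isPartition-raisedShape sX pS =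
    isPartition-++⁺ m≤X+m (ℕ.≤-refl ∷ S≤m)
      (Linked.map⁺ (Linked.map (ℕ.+-monoˡ-≤ m) sX) , All.map (ℕ.≤-trans 1≤m) m≤X+m)
      (isPartition-++⁺ (ℕ.≤-refl ∷ []) S≤m ([-] , 1≤m ∷ []) pS)

  correspond : ∀ u → Sorted X → IsPartition S →
               Correspond m (+ u - + length X) (hookShape m X u S) (length X) (raisedShape m X S)
  correspond u sX pS = record
    { isPartitionˡ   = isPartition-hookShape u sX pS
    ; isPartitionʳ   = isPartition-raisedShape sX pS
    ; sum-shift      = sum-raisedShape u
    ; part≡          = part-length-++ X m _
    ; hook≡          = trans (hook-hookShape u) (sym (hook-of-offset u (length X)))
    ; rightCondition = mult-raisedShape , gaps-raisedShape ,
                       subst (λ c → - (+ u - + length X) ℤ.≤ + c) (sym partsAtLeast-raisedShape) (bound-of-offset u (length X))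
    ; raise≡         = raise-hookShape u
    ; lower≡         = lower-raisedShape u
    ; row≡           = partsAtLeast-raisedShape
    }

raise-correspond : ∀ {m h l j} → 1 ≤ m → IsPartition l → part l (suc j) ≡ m → hook l (suc j) m ≡ + suc j ℤ.+ h →
                   Correspond m h l j (raise m j l)
raise-correspond {m} {h} 1≤m isP part≡ hook≡ with hookRow-of 1≤m (proj₁ isP) part≡
... | hookRow {X} {S} u m≤X S<m = subst (Correspond m h (hookShape m X u S) (length X)) (sym (Correspond.raise≡ c)) c
  where
  open Shapes 1≤m m≤X S<m
  h≡ : h ≡ + u - + length X
  h≡ = offset-of-hook (trans (sym (hook-hookShape u)) hook≡)
  c : Correspond m h (hookShape m X u S) (length X) (raisedShape m X S)
  c = subst (λ h → Correspond m h (hookShape m X u S) (length X) (raisedShape m X S)) (sym h≡)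
            (let (sX , pS) = isPartition-hookShape⁻ X u S isP in correspond u sX pS)

lower-correspond : ∀ {m h μ} → 1 ≤ m → IsPartition μ → RightCondition h m μ →
                   Correspond m h (lower m h μ) (partsAtLeast (2 ℕ.* m) μ) μ
lower-correspond {m} {h} 1≤m isP (once , gaps , bound) with oneCopy-of (proj₁ isP) once
... | oneCopy {C} {S} m<C S<m with unshift {m} (All.zipWith (λ (m<x , gap) → gap-above m<x gap) (m<C , All.++⁻ˡ C gaps))
... | X , m≤X , refl = subst₂ (λ l j → Correspond m h l j (raisedShape m X S)) (sym (Correspond.lower≡ c)) (sym (Correspond.row≡ c)) c
  where
  open Shapes 1≤m m≤X S<m
  offset = offset-of-bound (subst (λ c → - h ℤ.≤ + c) partsAtLeast-raisedShape bound)
  u = proj₁ offset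
  c : Correspond m h (hookShape m X u S) (length X) (raisedShape m X S)
  c = subst (λ h → Correspond m h (hookShape m X u S) (length X) (raisedShape m X S)) (sym (proj₂ offset))
            (let (sX , pS) = isPartition-raisedShape⁻ X S isP in correspond u sX pS)

module Bijection (m : ℕ) (1≤m : 1 ≤ m) (n : ℕ) (h : ℤ) where

  Hooked Raised : Set
  Hooked = Σ (PartitionOf (+ n)) (λ p → FixedHookFromPart h m (proj₁ p))
  Raised = Σ (PartitionOf (+ n - + m * h)) (λ p → RightCondition h m (proj₁ p))

  Hooked-≡ : ∀ {a b : Hooked} → proj₁ (proj₁ a) ≡ proj₁ (proj₁ b) → proj₁ (proj₂ a) ≡ proj₁ (proj₂ b) → a ≡ b
  Hooked-≡ {(l , p , s) , i , a₁ , a₂ , a₃ , a₄} {(.l , p′ , s′) , .i , b₁ , b₂ , b₃ , b₄} refl refl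
    with isPartition-irrelevant p p′ | ℤ-≡-irrelevant s s′ | ℕ.≤-irrelevant a₁ b₁ | ℕ.≤-irrelevant a₂ b₂
       | ℕ.≡-irrelevant a₃ b₃ | ℤ-≡-irrelevant a₄ b₄
  ... | refl | refl | refl | refl | refl | refl = refl

  Raised-≡ : ∀ {a b : Raised} → proj₁ (proj₁ a) ≡ proj₁ (proj₁ b) → a ≡ b
  Raised-≡ {(μ , p , s) , r} {(.μ , p′ , s′) , r′} refl
    with isPartition-irrelevant p p′ | ℤ-≡-irrelevant s s′ | rightCondition-irrelevant 1≤m r r′
  ... | refl | refl | refl = refl

  to : Hooked → Raised
  to ((l , isP , sum≡n) , suc j , _ , _ , part≡ , hook≡) =
    (raise m j l , isPartitionʳ , trans sum-shift (cong (_- + m * h) sum≡n)) , rightCondition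
    where open Correspond (raise-correspond {h = h} 1≤m isP part≡ hook≡)

  from : Raised → Hooked
  from ((μ , isP , sum≡) , rc) =
    (lower m h μ , isPartitionˡ , sub-cancelʳ {k = + m * h} (trans (sym sum-shift) sum≡)) ,
    suc (partsAtLeast (2 ℕ.* m) μ) , s≤s z≤n , ℕ.≤-reflexive (sym part≡) , part≡ , hook≡
    where open Correspond (lower-correspond {h = h} 1≤m isP rc)

  to∘from : ∀ y → to (from y) ≡ y
  to∘from ((μ , isP , _) , rc) = Raised-≡ (Correspond.raise≡ (lower-correspond {h = h} 1≤m isP rc))

  from∘to : ∀ x → from (to x) ≡ x
  from∘to ((l , isP , _) , suc j , _ , _ , part≡ , hook≡) = Hooked-≡ lower≡ (cong suc row≡)
    where open Correspond (raise-correspond {h = h} 1≤m isP part≡ hook≡)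

theorem1p3 : (m : ℕ) → 1 ≤ m → (n : ℕ) → (h : ℤ) →
    (Σ (PartitionOf (+ n)) (λ p → FixedHookFromPart h m (proj₁ p)))
      ↔ (Σ (PartitionOf (+ n - + m * h)) (λ p → RightCondition h m (proj₁ p)))
theorem1p3 m 1≤m n h = mk↔ₛ′ to from to∘from from∘to
  where open Bijection m 1≤m n h
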